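{- Let $\lambda$ be a partition with at most $n$ parts, let $\beta,\beta'\in U_\lambda(n)$, and set $\delta:=\Delta_\lambda(\beta)\in UI_\lambda(n)$. (i) $\mathcal{S}_\lambda(\beta)=\{T\in\mathcal{T}_\lambda: T\le Q_\lambda(\beta)\}$, and hence $\mathcal{S}_\lambda(\beta)=\mathcal{S}_\lambda(\beta')$ if and only if $Q_\lambda(\beta)=Q_\lambda(\beta')$. (ii) $M_\lambda(\delta)=Q_\lambda(\beta)$, and hence $\mathcal{S}_\lambda(\beta)=\{T\in\mathcal{T}_\lambda:T\le M_\lambda(\delta)\}$.
   Context: Fix $n\ge1$, $[n]=\{1,\dots,n\}$. A partition $\lambda=(\lambda_1\ge\dots\ge\lambda_n\ge0)$; box $(j,i)$ of its shape is in column $j$, row $i$. $R_\lambda\subseteq[n-1]$ is the set of distinct column lengths of $\lambda$ less than $n$, written $q_1<\dots<q_r$, $q_0:=0$, $q_{r+1}:=n$; carrels are $(q_{h-1},q_h]$, $h\in[r+1]$ ($\lambda_i$ is constant on each carrel). A $\lambda$-tuple is an $n$-tuple with entries in $[n]$; upper if $\beta_i\ge i$; $U_\lambda(n)$ the upper ones; $UI_\lambda(n)$ the upper ones strictly increasing on each carrel. Critical indices of $\beta\in U_\lambda(n)$: in carrel $h$ put $x_1:=q_h$; recursively $x_u$ is the largest index with $q_{h-1}<x_u<x_{u-1}$ and $\beta_{x_{u-1}}-\beta_{x_u}>x_{u-1}-x_u$, stopping when none exists. $\lambda$-core: $\Delta_\lambda(\beta)_i:=\beta_x-(x-i)$, $x$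 the smallest critical index $\ge i$ in the carrel of $i$. $\mathcal{T}_\lambda$: semistandard tableaux of shape $\lambda$ with entries in $[n]$ (strict down columns, weak along rows), partially ordered entrywise ($T\le T'$ iff every entry of $T$ is at most the corresponding entry of $T'$); $T_j(i)$ the entry in box $(j,i)$. $\mathcal{S}_\lambda(\beta):=\{T\in\mathcal{T}_\lambda:T_j(i)\le\beta_i\text{ for all boxes}\}$. $Q_\lambda(\beta)$ is the least upper bound in $\mathcal{T}_\lambda$ (entrywise maximum) of the tableaux in $\mathcal{S}_\lambda(\beta)$. The $\lambda$-row end list of $T\in\mathcal{T}_\lambda$ is $\omega$ with $\omega_i:=T_{\lambda_i}(i)$, where if $\lambda_i=0$ one uses $T_0(i):=i$. For $\alpha\in UI_\lambda(n)$, $M_\lambda(\alpha)$ is the unique maximal element of the (nonempty, join-closed) set of $T\in\mathcal{T}_\lambda$ whose $\lambda$-row end list is $\alpha$. -}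

module Defs where

open import Data.Nat using (ℕ; zero; suc; _+_; _∸_; _≤_; _<_; _≤ᵇ_; _<ᵇ_; _≡ᵇ_)
open import Data.Bool using (Bool; true; false; if_then_else_; _∧_; _∨_)
open import Data.Maybe using (Maybe; just; nothing; fromMaybe)
open import Data.Product using (_×_)
open import Relation.Binary.PropositionalEquality using (_≡_)
open import Function.Bundles using (_⇔_)

-- Conventions (1-indexed, matching the paper).
-- A shape  lam : ℕ → ℕ  gives  λ_i = lam i  for rows i ∈ [n] = {1..n};
-- values of lam outside [n] are never used.
-- A tableau  T : ℕ → ℕ → ℕ  gives the entry  T_j(i) = T j i  in box
-- (j,i) (column j, row i); values outside the shape are irrelevant,
-- so tableaux are compared only on the boxes of the shape.

Shape : Set
Shape = ℕ → ℕ

Tuple : Set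
Tuple = ℕ → ℕ

Tableau : Set
Tableau = ℕ → ℕ → ℕ

IsPartition : ℕ → Shape → Set
IsPartition n lam = ∀ i → 1 ≤ i → suc i ≤ n → lam (suc i) ≤ lam i

IsUpper : ℕ → Tuple → Set
IsUpper n β = ∀ i → 1 ≤ i → i ≤ n → (i ≤ β i) × (β i ≤ n)

count : (ℕ → Bool) → ℕ → ℕ
count f zero    = 0
count f (suc m) = (if f (suc m) then 1 else 0) + count f m

anyTo : (ℕ → Bool) → ℕ → Bool
anyTo f zero    = false
anyTo f (suc m) = f (suc m) ∨ anyTo f m

findUp : ℕ → (ℕ → Bool) → ℕ → ℕ → ℕ
findUp zero    f s d = d
findUp (suc k) f s d = if f s then s else findUp k f (suc s) d

findDownM : ℕ → (ℕ → Bool) → ℕ → Maybe ℕ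
findDownM zero    f s = nothing
findDownM (suc k) f s = if f s then just s else findDownM k f (s ∸ 1)

colLen : ℕ → Shape → ℕ → ℕ
colLen n lam j = count (λ i → j ≤ᵇ lam i) n

isR : ℕ → Shape → ℕ → Bool
isR n lam c = (1 ≤ᵇ c) ∧ ((c <ᵇ n) ∧ anyTo (λ j → colLen n lam j ≡ᵇ c) (lam 1))

-- upper end q_h of the carrel (q_{h-1}, q_h] containing i ∈ [n]:
-- the least element of R_λ ∪ {n} that is ≥ i
carrelTop : ℕ → Shape → ℕ → ℕ
carrelTop n lam i = findUp (n ∸ i) (isR n lam) i n

-- lower end q_{h-1}: the largest element of R_λ ∪ {0} that is < i
carrelBot : ℕ → Shape → ℕ → ℕ
carrelBot n lam i = fromMaybe 0 (findDownM (i ∸ 1) (isR n lam) (i ∸ 1))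

-- β_y − β_x > y − x   (written without subtraction)
critCond : Tuple → ℕ → ℕ → Bool
critCond β y x = (β x + y) <ᵇ (β y + x)

nextCrit : Tuple → ℕ → ℕ → Maybe ℕ
nextCrit β bot y = findDownM (y ∸ 1 ∸ bot) (critCond β y) (y ∸ 1)

-- walk down the chain of critical indices x_1 = q_h > x_2 > … starting
-- at x, and return the smallest critical index that is ≥ i
-- (fuel bounds the chain length)
climb : ℕ → Tuple → ℕ → ℕ → ℕ → ℕ
climb zero    β bot i x = x
climb (suc k) β bot i x with nextCrit β bot x
... | nothing = x
... | just x' = if i ≤ᵇ x' then climb k β bot i x' else x

critAbove : ℕ → Shape → Tuple → ℕ → ℕ
critAbove n lam β i = climb n β (carrelBot n lam i) i (carrelTop n lam i)

Δ : ℕ → Shape → Tuple → Tuple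
Δ n lam β i = β (critAbove n lam β i) + i ∸ critAbove n lam β i

InShape : ℕ → Shape → ℕ → ℕ → Set
InShape n lam j i = (1 ≤ i × i ≤ n) × (1 ≤ j × j ≤ lam i)

record IsSSYT (n : ℕ) (lam : Shape) (T : Tableau) : Set where
  field
    entries : ∀ j i → InShape n lam j i → (1 ≤ T j i) × (T j i ≤ n)
    rowWeak : ∀ j i → InShape n lam j i → InShape n lam (suc j) i →
              T j i ≤ T (suc j) i
    colStrict : ∀ j i → InShape n lam j i → InShape n lam j (suc i) →
                T j i < T j (suc i)

LeT : ℕ → Shape → Tableau → Tableau → Set
LeT n lam T U = ∀ j i → InShape n lam j i → T j i ≤ U j i

EqT : ℕ → Shape → Tableau → Tableau → Set
EqT n lam T U = ∀ j i → InShape n lam j i → T j i ≡ U j i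

InS : ℕ → Shape → Tuple → Tableau → Set
InS n lam β T = IsSSYT n lam T × (∀ j i → InShape n lam j i → T j i ≤ β i)

IsLUB : ℕ → Shape → (Tableau → Set) → Tableau → Set
IsLUB n lam P Q =
  IsSSYT n lam Q
  × (∀ T → P T → LeT n lam T Q)
  × (∀ U → IsSSYT n lam U → (∀ T → P T → LeT n lam T U) → LeT n lam Q U)

-- λ-row end list: ω_i = T_{λ_i}(i), with T_0(i) := i
rowEnd : Shape → Tableau → Tuple
rowEnd lam T i = if lam i ≡ᵇ 0 then i else T (lam i) i

-- M is the (unique) maximal, i.e. greatest, element of
-- { T ∈ 𝒯_λ : λ-row end list of T is α }   (this is M_λ(α))
IsMaxRowEnd : ℕ → Shape → Tuple → Tableau → Set
IsMaxRowEnd n lam α M =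
  IsSSYT n lam M
  × (∀ i → 1 ≤ i → i ≤ n → rowEnd lam M i ≡ α i)
  × (∀ T → IsSSYT n lam T → (∀ i → 1 ≤ i → i ≤ n → rowEnd lam T i ≡ α i) →
       LeT n lam T M)

-- S_λ(β) has a greatest element Qβ, filled in column by column from the bottom row up: every entry
-- is the largest value that β allows and that stays strictly below the entry underneath. Hence the
-- least upper bound Q is Qβ, and S_λ(β) is the down-set of Q, which is (i). Unwinding the recursion,
-- the last entry of row i of Qβ is min { β_k − (k − i) : i ≤ k ≤ q } over the carrel (·, q] of i,
-- and the smallest critical index x ≥ i is precisely an index attaining min { β_k − k : i ≤ k ≤ q },
-- so Qβ has λ-row end list δ = Δ_λ(β). Therefore Qβ ≤ M_λ(δ) by maximality, while M_λ(δ) ∈ S_λ(β)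
-- because each of its entries is at most its row end δ_i ≤ β_i; so M_λ(δ) = Qβ = Q, which is (ii).
module Submission where

open import Defs
open import Data.Nat
open import Data.Nat.Properties
open import Data.Nat.Tactic.RingSolver using (solve-∀)
open import Data.Bool using (Bool; true; false; T; _∧_; _∨_)
open import Data.Bool.Properties using (T-≡)
open import Data.Maybe using (just; nothing)
open import Data.Product using (∃; _×_; _,_; proj₁; proj₂)
open import Data.Sum using (_⊎_; inj₁; inj₂)
open import Relation.Nullary using (yes; no; contradiction)
open import Relation.Binary.PropositionalEquality
open import Function.Bundles using (_⇔_; mk⇔; Equivalence)
import Function.Properties.Equivalence as ⇔

open Equivalence using (to; from)

≤ᵇ≡true⇒≤ : ∀ {m n} → (m ≤ᵇ n) ≡ true → m ≤ n
≤ᵇ≡true⇒≤ {m} {n} e = ≤ᵇ⇒≤ m n (from T-≡ e)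

≤ᵇ≡false⇒> : ∀ {m n} → (m ≤ᵇ n) ≡ false → n < m
≤ᵇ≡false⇒> e = ≰⇒> (λ m≤n → subst T e (≤⇒≤ᵇ m≤n))

<ᵇ≡true⇒< : ∀ {m n} → (m <ᵇ n) ≡ true → m < n
<ᵇ≡true⇒< {m} {n} e = <ᵇ⇒< m n (from T-≡ e)

<ᵇ≡false⇒≥ : ∀ {m n} → (m <ᵇ n) ≡ false → n ≤ m
<ᵇ≡false⇒≥ e = ≮⇒≥ (λ m<n → subst T e (<⇒<ᵇ m<n))

≡ᵇ≡true⇒≡ : ∀ {m n} → (m ≡ᵇ n) ≡ true → m ≡ n
≡ᵇ≡true⇒≡ {m} {n} e = ≡ᵇ⇒≡ m n (from T-≡ e)

≤⇒≤ᵇ≡true : ∀ {m n} → m ≤ n → (m ≤ᵇ n) ≡ true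
≤⇒≤ᵇ≡true m≤n = to T-≡ (≤⇒≤ᵇ m≤n)

<⇒<ᵇ≡true : ∀ {m n} → m < n → (m <ᵇ n) ≡ true
<⇒<ᵇ≡true m<n = to T-≡ (<⇒<ᵇ m<n)

≡⇒≡ᵇ≡true : ∀ {m n} → m ≡ n → (m ≡ᵇ n) ≡ true
≡⇒≡ᵇ≡true {m} {n} m≡n = to T-≡ (≡⇒≡ᵇ m n m≡n)

>⇒≤ᵇ≡false : ∀ {m n} → n < m → (m ≤ᵇ n) ≡ false
>⇒≤ᵇ≡false {m} {n} n<m with m ≤ᵇ n in e
... | true  = contradiction (≤ᵇ≡true⇒≤ e) (<⇒≱ n<m)
... | false = refl

∧≡true⇒ : ∀ {a b} → a ∧ b ≡ true → a ≡ true × b ≡ true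
∧≡true⇒ {true} e = refl , e

∧-true : ∀ {a b} → a ≡ true → b ≡ true → a ∧ b ≡ true
∧-true refl refl = refl

∨≡true⇒ : ∀ {a b} → a ∨ b ≡ true → a ≡ true ⊎ b ≡ true
∨≡true⇒ {true}  _ = inj₁ refl
∨≡true⇒ {false} e = inj₂ e

+-swapʳ : ∀ a b c → a + b + c ≡ a + c + b
+-swapʳ = solve-∀

∸1< : ∀ {m} → 1 ≤ m → m ∸ 1 < m
∸1< = ∸-monoʳ-< z<s

findUp-spec : ∀ k (f : ℕ → Bool) s d → d ≡ s + k → let r = findUp k f s d in
  s ≤ r × r ≤ d × (∀ u → s ≤ u → u < r → f u ≡ false) × (r < d → f r ≡ true)
findUp-spec zero f s d refl rewrite +-identityʳ s =
  ≤-refl , ≤-refl , (λ u s≤u u<s → contradiction s≤u (<⇒≱ u<s)) , (λ s<s → contradiction s<s (n≮n s))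
findUp-spec (suc k) f s d d≡s+k with f s in fs
... | true  = ≤-refl , subst (s ≤_) (sym d≡s+k) (m≤m+n s (suc k)) ,
              (λ u s≤u u<s → contradiction s≤u (<⇒≱ u<s)) , (λ _ → fs)
... | false with findUp-spec k f (suc s) d (trans d≡s+k (+-suc s k))
... | s<r , r≤d , skipped , found = ≤-trans (n≤1+n s) s<r , r≤d , skipped′ , found
  where
    skipped′ : ∀ u → s ≤ u → u < findUp k f (suc s) d → f u ≡ false
    skipped′ u s≤u u<r with m≤n⇒m<n∨m≡n s≤u
    ... | inj₁ s<u  = skipped u s<u u<r
    ... | inj₂ refl = fs

findDownM-just : ∀ k (f : ℕ → Bool) s {t} → findDownM k f s ≡ just t →
  f t ≡ true × t ≤ s × (∀ u → t < u → u ≤ s → f u ≡ false)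
findDownM-just zero f s ()
findDownM-just (suc k) f s e with f s in fs
findDownM-just (suc k) f s refl | true = fs , ≤-refl , λ u s<u u≤s → contradiction u≤s (<⇒≱ s<u)
findDownM-just (suc k) f s {t} e | false with findDownM-just k f (s ∸ 1) e
... | ft , t≤s∸1 , skipped = ft , ≤-trans t≤s∸1 (m∸n≤m s 1) , skipped′
  where
    skipped′ : ∀ u → t < u → u ≤ s → f u ≡ false
    skipped′ u t<u u≤s with m≤n⇒m<n∨m≡n u≤s
    ... | inj₁ u<s  = skipped u t<u (∸-monoˡ-≤ 1 u<s)
    ... | inj₂ refl = fs

findDownM-nothing : ∀ k (f : ℕ → Bool) s → findDownM k f s ≡ nothing →
  ∀ u → s ∸ k < u → u ≤ s → f u ≡ false
findDownM-nothing zero f s _ u s<u u≤s = contradiction u≤s (<⇒≱ s<u)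
findDownM-nothing (suc k) f s e u above u≤s with f s in fs
findDownM-nothing (suc k) f s () u above u≤s | true
... | false with m≤n⇒m<n∨m≡n u≤s
... | inj₂ refl = fs
... | inj₁ u<s  = findDownM-nothing k f (s ∸ 1) e u
                    (subst (_< u) (sym (∸-+-assoc s 1 k)) above) (∸-monoˡ-≤ 1 u<s)

count≤ : ∀ f m → count f m ≤ m
count≤ f zero = ≤-refl
count≤ f (suc m) with f (suc m)
... | true  = s≤s (count≤ f m)
... | false = m≤n⇒m≤1+n (count≤ f m)

count-mono : ∀ f {c m} → c ≤ m → count f c ≤ count f m
count-mono f {c} {m} c≤m with m≤n⇒m<n∨m≡n c≤m
... | inj₂ refl = ≤-refl
count-mono f {c} {suc m} _ | inj₁ c<1+m =
  ≤-trans (count-mono f (s≤s⁻¹ c<1+m)) (m≤n+m (count f m) _)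

count-allTrue : ∀ f m → (∀ k → 1 ≤ k → k ≤ m → f k ≡ true) → count f m ≡ m
count-allTrue f zero _ = refl
count-allTrue f (suc m) all rewrite all (suc m) z<s ≤-refl =
  cong suc (count-allTrue f m (λ k 1≤k k≤m → all k 1≤k (m≤n⇒m≤1+n k≤m)))

count-falseTail : ∀ f {c} m → c ≤ m → (∀ k → c < k → k ≤ m → f k ≡ false) → count f m ≡ count f c
count-falseTail f m c≤m none with m≤n⇒m<n∨m≡n c≤m
... | inj₂ refl = refl
count-falseTail f (suc m) _ none | inj₁ c<1+m rewrite none (suc m) c<1+m ≤-refl =
  count-falseTail f m (s≤s⁻¹ c<1+m) (λ k c<k k≤m → none k c<k (m≤n⇒m≤1+n k≤m))

anyTo⇒witness : ∀ f m → anyTo f m ≡ true → ∃ λ j → 1 ≤ j × j ≤ m × f j ≡ true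
anyTo⇒witness f zero ()
anyTo⇒witness f (suc m) e with ∨≡true⇒ {f (suc m)} e
... | inj₁ here = suc m , z<s , ≤-refl , here
... | inj₂ there with anyTo⇒witness f m there
... | j , 1≤j , j≤m , fj = j , 1≤j , m≤n⇒m≤1+n j≤m , fj

witness⇒anyTo : ∀ f m {j} → 1 ≤ j → j ≤ m → f j ≡ true → anyTo f m ≡ true
witness⇒anyTo f zero 1≤j j≤0 _ = contradiction j≤0 (<⇒≱ 1≤j)
witness⇒anyTo f (suc m) 1≤j j≤1+m fj with m≤n⇒m<n∨m≡n j≤1+m
... | inj₂ refl rewrite fj = refl
... | inj₁ j<1+m with f (suc m)
...   | true  = refl
...   | false = witness⇒anyTo f m 1≤j (s≤s⁻¹ j<1+m) fj

record IsCarrelTop (n : ℕ) (lam : Shape) (i q : ℕ) : Set where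
  field
    i≤q       : i ≤ q
    q≤n       : q ≤ n
    constant  : ∀ m → i ≤ m → m ≤ q → lam m ≡ lam i
    dropAfter : q < n → lam (suc q) < lam i

carrelBot< : ∀ n lam {i} → 1 ≤ i → carrelBot n lam i < i
carrelBot< n lam {i} 1≤i with findDownM (i ∸ 1) (isR n lam) (i ∸ 1) in e
... | nothing = 1≤i
... | just t  = ≤-<-trans (proj₁ (proj₂ (findDownM-just (i ∸ 1) (isR n lam) (i ∸ 1) e))) (∸1< 1≤i)

module Carrels {n : ℕ} {lam : Shape} (par : IsPartition n lam) where

  lam-antitone : ∀ {k u} → 1 ≤ k → k ≤ u → u ≤ n → lam u ≤ lam k
  lam-antitone {k} {u} 1≤k k≤u u≤n with m≤n⇒m<n∨m≡n k≤u
  ... | inj₂ refl = ≤-refl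
  lam-antitone {k} {suc u} 1≤k _ 1+u≤n | inj₁ k<1+u =
    ≤-trans (par u (≤-trans 1≤k (s≤s⁻¹ k<1+u)) 1+u≤n)
            (lam-antitone 1≤k (s≤s⁻¹ k<1+u) (≤-trans (n≤1+n u) 1+u≤n))

  j≤lam⇒u≤colLen : ∀ {j u} → 1 ≤ u → u ≤ n → j ≤ lam u → u ≤ colLen n lam j
  j≤lam⇒u≤colLen {j} {u} 1≤u u≤n j≤lam-u = begin
    u                            ≡⟨ count-allTrue _ u inColumn ⟨
    count (λ k → j ≤ᵇ lam k) u   ≤⟨ count-mono _ u≤n ⟩
    colLen n lam j               ∎
    where
      open ≤-Reasoning
      inColumn : ∀ k → 1 ≤ k → k ≤ u → (j ≤ᵇ lam k) ≡ true
      inColumn k 1≤k k≤u = ≤⇒≤ᵇ≡true (≤-trans j≤lam-u (lam-antitone 1≤k k≤u u≤n))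

  colLen<-below : ∀ {j} u → 1 ≤ u → u ≤ n → lam u < j → colLen n lam j < u
  colLen<-below {j} (suc u) _ 1+u≤n lam-u<j = s≤s (begin
    count (λ k → j ≤ᵇ lam k) n   ≡⟨ count-falseTail _ n (≤-trans (n≤1+n u) 1+u≤n) outside ⟩
    count (λ k → j ≤ᵇ lam k) u   ≤⟨ count≤ _ u ⟩
    u                            ∎)
    where
      open ≤-Reasoning
      outside : ∀ k → u < k → k ≤ n → (j ≤ᵇ lam k) ≡ false
      outside k u<k k≤n = >⇒≤ᵇ≡false (≤-<-trans (lam-antitone z<s u<k k≤n) lam-u<j)

  u≤colLen⇒j≤lam : ∀ {j u} → 1 ≤ u → u ≤ n → u ≤ colLen n lam j → j ≤ lam u
  u≤colLen⇒j≤lam {j} {u} 1≤u u≤n u≤colLen with j ≤? lam u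
  ... | yes j≤lam-u = j≤lam-u
  ... | no  j≰lam-u = contradiction u≤colLen (<⇒≱ (colLen<-below u 1≤u u≤n (≰⇒> j≰lam-u)))

  colLen-atDescent : ∀ {u} → 1 ≤ u → u < n → lam (suc u) < lam u → colLen n lam (lam u) ≡ u
  colLen-atDescent 1≤u u<n descent = ≤-antisym
    (≮⇒≥ (λ u<c → <⇒≱ descent (u≤colLen⇒j≤lam z<s u<n u<c)))
    (j≤lam⇒u≤colLen 1≤u (<⇒≤ u<n) ≤-refl)

  isR-atDescent : ∀ {u} → 1 ≤ u → u < n → lam (suc u) < lam u → isR n lam u ≡ true
  isR-atDescent 1≤u u<n descent = ∧-true (≤⇒≤ᵇ≡true 1≤u) (∧-true (<⇒<ᵇ≡true u<n)
    (witness⇒anyTo _ (lam 1) (≤-trans z<s descent) (lam-antitone ≤-refl 1≤u (<⇒≤ u<n))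
       (≡⇒≡ᵇ≡true (colLen-atDescent 1≤u u<n descent))))

  isR⇒descent : ∀ {q} → isR n lam q ≡ true → q < n × lam (suc q) < lam q
  isR⇒descent {q} e with ∧≡true⇒ {1 ≤ᵇ q} e
  ... | e₁ , e′ with ∧≡true⇒ {q <ᵇ n} e′
  ... | e₂ , e₃ with anyTo⇒witness _ (lam 1) e₃
  ... | j , _ , _ , isColLen = q<n , <-≤-trans lam-1+q<j j≤lam-q
    where
      1≤q = ≤ᵇ≡true⇒≤ e₁
      q<n = <ᵇ≡true⇒< e₂
      colLen≡q = ≡ᵇ≡true⇒≡ isColLen
      j≤lam-q : j ≤ lam q
      j≤lam-q = u≤colLen⇒j≤lam 1≤q (<⇒≤ q<n) (≤-reflexive (sym colLen≡q))
      lam-1+q<j : lam (suc q) < j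
      lam-1+q<j = ≰⇒> (λ j≤ → n≮n q (subst (suc q ≤_) colLen≡q (j≤lam⇒u≤colLen z<s q<n j≤)))

  carrelTop-spec : ∀ {i} → 1 ≤ i → i ≤ n → IsCarrelTop n lam i (carrelTop n lam i)
  carrelTop-spec {i} 1≤i i≤n with findUp-spec (n ∸ i) (isR n lam) i n (sym (m+[n∸m]≡n i≤n))
  ... | i≤q , q≤n , notR , isR-q = record
    { i≤q = i≤q ; q≤n = q≤n ; constant = constant ; dropAfter = dropAfter }
    where
      constant : ∀ m → i ≤ m → m ≤ carrelTop n lam i → lam m ≡ lam i
      constant m i≤m m≤q with m≤n⇒m<n∨m≡n i≤m
      ... | inj₂ refl = refl
      constant (suc m) _ m<q | inj₁ i<1+m = trans flat (constant m i≤m (<⇒≤ m<q))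
        where
          i≤m = s≤s⁻¹ i<1+m
          flat : lam (suc m) ≡ lam m
          flat = ≤-antisym (par m (≤-trans 1≤i i≤m) (≤-trans m<q q≤n))
            (≮⇒≥ (λ descent → contradiction
              (trans (sym (isR-atDescent (≤-trans 1≤i i≤m) (<-≤-trans m<q q≤n) descent)) (notR m i≤m m<q))
              (λ ())))
      dropAfter : carrelTop n lam i < n → lam (suc (carrelTop n lam i)) < lam i
      dropAfter q<n = subst (lam (suc (carrelTop n lam i)) <_) (constant _ i≤q ≤-refl)
                            (proj₂ (isR⇒descent (isR-q q<n)))

-- β_x − x ≤ β_k − k, written without subtraction
GapLe : Tuple → ℕ → ℕ → Set
GapLe β x k = β x + k ≤ β k + x

GapMinOn : Tuple → ℕ → ℕ → ℕ → Set
GapMinOn β a b x = ∀ k → a ≤ k → k ≤ b → GapLe β x k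

GapLe-trans : ∀ β {x y z} → GapLe β x y → GapLe β y z → GapLe β x z
GapLe-trans β {x} {y} {z} x≼y y≼z = +-cancelʳ-≤ (β y + y) (β x + z) (β z + x) (begin
  β x + z + (β y + y)     ≡⟨ regroup (β x) z (β y) y ⟩
  β x + y + (β y + z)     ≤⟨ +-mono-≤ x≼y y≼z ⟩
  β y + x + (β z + y)     ≡⟨ regroup (β y) x (β z) y ⟩
  β y + y + (β z + x)     ≡⟨ +-comm (β y + y) (β z + x) ⟩
  β z + x + (β y + y)     ∎)
  where
    open ≤-Reasoning
    regroup : ∀ a b c d → a + b + (c + d) ≡ a + d + (c + b)
    regroup = solve-∀

GapMinOn-extend : ∀ β {a b c x} → GapMinOn β c b x → (∀ k → a ≤ k → k < c → GapLe β x k) →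
                  GapMinOn β a b x
GapMinOn-extend β {c = c} above below k a≤k k≤b with k <? c
... | yes k<c = below k a≤k k<c
... | no  k≮c = above k (≮⇒≥ k≮c) k≤b

critCond≡false⇒GapLe : ∀ β {y k} → critCond β y k ≡ false → GapLe β y k
critCond≡false⇒GapLe β = <ᵇ≡false⇒≥

critCond≡true⇒GapLe : ∀ β {y x} → critCond β y x ≡ true → GapLe β x y
critCond≡true⇒GapLe β e = <⇒≤ (<ᵇ≡true⇒< e)

-- Each step of the chain of critical indices moves to the nearest index with a strictly smaller
-- gap β_x − x, so the gaps passed over are never smaller than the current one.
module Critical (β : Tuple) {b i q : ℕ} (b<i : b < i) where

  climb-spec : ∀ f x → i ≤ x → x ≤ q → GapMinOn β x q x → x < f + i →
               let y = climb f β b i x in i ≤ y × y ≤ q × GapMinOn β i q y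
  climb-spec zero x i≤x _ _ x<i = contradiction i≤x (<⇒≱ x<i)
  climb-spec (suc f) x i≤x x≤q min x<f+i with nextCrit β b x in e
  ... | nothing = i≤x , x≤q , GapMinOn-extend β min λ k i≤k k<x →
        critCond≡false⇒GapLe β
          (findDownM-nothing (x ∸ 1 ∸ b) (critCond β x) (x ∸ 1) e k (window i≤k) (∸-monoˡ-≤ 1 k<x))
    where
      window : ∀ {k} → i ≤ k → x ∸ 1 ∸ (x ∸ 1 ∸ b) < k
      window i≤k = subst (_< _) (sym (m∸[m∸n]≡n (∸-monoˡ-≤ 1 (<-≤-trans b<i i≤x)))) (<-≤-trans b<i i≤k)
  ... | just x′ with findDownM-just (x ∸ 1 ∸ b) (critCond β x) (x ∸ 1) e
  ... | x′-crit , x′≤x∸1 , skipped with i ≤ᵇ x′ in i≤ᵇx′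
  ... | false = i≤x , x≤q , GapMinOn-extend β min λ k i≤k k<x →
        critCond≡false⇒GapLe β (skipped k (<-≤-trans (≤ᵇ≡false⇒> i≤ᵇx′) i≤k) (∸-monoˡ-≤ 1 k<x))
  ... | true = climb-spec f x′ (≤ᵇ≡true⇒≤ i≤ᵇx′) (≤-trans (<⇒≤ x′<x) x≤q) min′ (<-≤-trans x′<x (s≤s⁻¹ x<f+i))
    where
      x′<x : x′ < x
      x′<x = ≤-<-trans x′≤x∸1 (∸1< (≤-trans z<s (<-≤-trans b<i i≤x)))
      x′≼x : GapLe β x′ x
      x′≼x = critCond≡true⇒GapLe β x′-crit
      between : ∀ k → x′ ≤ k → k < x → GapLe β x′ k
      between k x′≤k k<x with m≤n⇒m<n∨m≡n x′≤k
      ... | inj₂ refl = ≤-refl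
      ... | inj₁ x′<k = GapLe-trans β x′≼x
                          (critCond≡false⇒GapLe β (skipped k x′<k (∸-monoˡ-≤ 1 k<x)))
      min′ : GapMinOn β x′ q x′
      min′ = GapMinOn-extend β (λ k x≤k k≤q → GapLe-trans β x′≼x (min k x≤k k≤q)) between

critAbove-spec : ∀ {n lam} → IsPartition n lam → ∀ β {i} → 1 ≤ i → i ≤ n →
  i ≤ critAbove n lam β i × critAbove n lam β i ≤ carrelTop n lam i
  × GapMinOn β i (carrelTop n lam i) (critAbove n lam β i)
critAbove-spec {n} {lam} par β {i} 1≤i i≤n =
  Critical.climb-spec β (carrelBot< n lam 1≤i) n q i≤q ≤-refl onlyItself (≤-<-trans q≤n (m<m+n n 1≤i))
  where
    open IsCarrelTop (Carrels.carrelTop-spec par 1≤i i≤n)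
    q = carrelTop n lam i
    onlyItself : GapMinOn β q q q
    onlyItself k q≤k k≤q rewrite ≤-antisym k≤q q≤k = ≤-refl

-- v = min { β_k − (k − i) : i ≤ k ≤ q }, written without subtraction
IsRunMin : Tuple → ℕ → ℕ → ℕ → Set
IsRunMin β i q v = (∀ k → i ≤ k → k ≤ q → v + k ≤ β k + i) × ∃ λ k → i ≤ k × k ≤ q × v + k ≡ β k + i

IsRunMin-unique : ∀ {β i q v w} → IsRunMin β i q v → IsRunMin β i q w → v ≡ w
IsRunMin-unique {β} {i} {q} (v-bound , v-attained) (w-bound , w-attained) =
  ≤-antisym (≤-attained v-bound w-attained) (≤-attained w-bound v-attained)
  where
    ≤-attained : ∀ {v w} → (∀ k → i ≤ k → k ≤ q → v + k ≤ β k + i) →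
                 (∃ λ k → i ≤ k × k ≤ q × w + k ≡ β k + i) → v ≤ w
    ≤-attained bound (k , i≤k , k≤q , attained) =
      +-cancelʳ-≤ k _ _ (≤-trans (bound k i≤k k≤q) (≤-reflexive (sym attained)))

IsRunMin⇒≤start : ∀ {β i q v} → IsRunMin β i q v → i ≤ q → v ≤ β i
IsRunMin⇒≤start {i = i} (bound , _) i≤q = +-cancelʳ-≤ i _ _ (bound i ≤-refl i≤q)

GapMinOn⇒IsRunMin : ∀ β {i q x v} → i ≤ x → x ≤ q → GapMinOn β i q x → v + x ≡ β x + i →
                    IsRunMin β i q v
GapMinOn⇒IsRunMin β {i} {q} {x} {v} i≤x x≤q min v+x≡ = bound , x , i≤x , x≤q , v+x≡
  where
    open ≤-Reasoning
    bound : ∀ k → i ≤ k → k ≤ q → v + k ≤ β k + i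
    bound k i≤k k≤q = +-cancelʳ-≤ x (v + k) (β k + i) (begin
      v + k + x      ≡⟨ +-swapʳ v k x ⟩
      v + x + k      ≡⟨ cong (_+ k) v+x≡ ⟩
      β x + i + k    ≡⟨ +-swapʳ (β x) i k ⟩
      β x + k + i    ≤⟨ +-monoˡ-≤ i (min k i≤k k≤q) ⟩
      β k + x + i    ≡⟨ +-swapʳ (β k) x i ⟩
      β k + i + x    ∎)

Δ-isRunMin : ∀ {n lam β} → IsPartition n lam → IsUpper n β → ∀ {i} → 1 ≤ i → i ≤ n →
             IsRunMin β i (carrelTop n lam i) (Δ n lam β i)
Δ-isRunMin {n} {lam} {β} par up {i} 1≤i i≤n with critAbove-spec par β 1≤i i≤n
... | i≤x , x≤q , min = GapMinOn⇒IsRunMin β i≤x x≤q min (m∸n+n≡m (≤-trans x≤βx (m≤m+n _ i)))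
  where
    x = critAbove n lam β i
    x≤βx : x ≤ β x
    x≤βx = proj₁ (up x (≤-trans 1≤i i≤x) (≤-trans x≤q (IsCarrelTop.q≤n (Carrels.carrelTop-spec par 1≤i i≤n))))

rowIndex-isRunMin : ∀ {n β} → IsUpper n β → ∀ {i} → 1 ≤ i → i ≤ n → IsRunMin β i n i
rowIndex-isRunMin {n} {β} up {i} 1≤i i≤n = bound , n , i≤n , ≤-refl , attained
  where
    bound : ∀ k → i ≤ k → k ≤ n → i + k ≤ β k + i
    bound k i≤k k≤n = subst (_≤ β k + i) (+-comm k i)
                        (+-monoˡ-≤ i (proj₁ (up k (≤-trans 1≤i i≤k) k≤n)))
    attained : i + n ≡ β n + i
    attained = trans (+-comm i n) (cong (_+ i)
                 (≤-antisym (proj₁ (up n (≤-trans 1≤i i≤n) ≤-refl)) (proj₂ (up n (≤-trans 1≤i i≤n) ≤-refl))))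

RunFrom : Shape → ℕ → ℕ → ℕ → Set
RunFrom lam j i k = ∀ m → i < m → m ≤ k → j ≤ lam m

module Greatest {n : ℕ} {lam : Shape} {β : Tuple} (up : IsUpper n β) where

  -- entry f j i is the entry in box (j, i) when f = n ∸ i, computed from the entry below it.
  entry : ℕ → ℕ → ℕ → ℕ
  entry zero    j i = β i
  entry (suc f) j i with j ≤? lam (suc i)
  ... | yes _ = β i ⊓ pred (entry f j (suc i))
  ... | no  _ = β i

  Qβ : Tableau
  Qβ j i = entry (n ∸ i) j i

  fuel⇒≤ : ∀ f {i} → f + i ≡ n → i ≤ n
  fuel⇒≤ f {i} refl = m≤n+m i f

  fuel-suc : ∀ f i → suc f + i ≡ n → f + suc i ≡ n
  fuel-suc f i e = trans (+-suc f i) e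

  row≤entry : ∀ f j i → 1 ≤ i → f + i ≡ n → i ≤ entry f j i
  row≤entry zero j i 1≤i e = proj₁ (up i 1≤i (fuel⇒≤ 0 e))
  row≤entry (suc f) j i 1≤i e with j ≤? lam (suc i)
  ... | yes _ = ⊓-glb (proj₁ (up i 1≤i (fuel⇒≤ (suc f) e))) (<⇒≤pred (row≤entry f j (suc i) z<s (fuel-suc f i e)))
  ... | no  _ = proj₁ (up i 1≤i (fuel⇒≤ (suc f) e))

  entry≤β : ∀ f j i → entry f j i ≤ β i
  entry≤β zero    j i = ≤-refl
  entry≤β (suc f) j i with j ≤? lam (suc i)
  ... | yes _ = m⊓n≤m _ _
  ... | no  _ = ≤-refl

  entry-monoʳ : ∀ f j i → entry f j i ≤ entry f (suc j) i
  entry-monoʳ zero    j i = ≤-refl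
  entry-monoʳ (suc f) j i with suc j ≤? lam (suc i) | j ≤? lam (suc i)
  ... | yes _    | yes _   = ⊓-monoʳ-≤ (β i) (pred-mono-≤ (entry-monoʳ f j (suc i)))
  ... | yes 1+j≤ | no  j≰  = contradiction (≤-trans (n≤1+n j) 1+j≤) j≰
  ... | no  _    | yes _   = m⊓n≤m _ _
  ... | no  _    | no  _   = ≤-refl

  InS⇒≤entry : ∀ {T} → InS n lam β T → ∀ f j i → f + i ≡ n → InShape n lam j i → T j i ≤ entry f j i
  InS⇒≤entry S zero    j i _ sh = proj₂ S j i sh
  InS⇒≤entry {T} S (suc f) j i e sh with j ≤? lam (suc i)
  ... | no  _         = proj₂ S j i sh
  ... | yes j≤lam-1+i = ⊓-glb (proj₂ S j i sh)
          (<⇒≤pred (<-≤-trans (IsSSYT.colStrict (proj₁ S) j i sh below)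
                              (InS⇒≤entry S f j (suc i) (fuel-suc f i e) below)))
    where
      below : InShape n lam j (suc i)
      below = (z<s , fuel⇒≤ f (fuel-suc f i e)) , proj₁ (proj₂ sh) , j≤lam-1+i

  entry-bound : ∀ f j i k → 1 ≤ i → f + i ≡ n → i ≤ k → k ≤ n → RunFrom lam j i k →
                entry f j i + k ≤ β k + i
  entry-bound f j i k 1≤i e i≤k k≤n run with m≤n⇒m<n∨m≡n i≤k
  ... | inj₂ refl = +-monoˡ-≤ i (entry≤β f j i)
  entry-bound zero j i k 1≤i e i≤k k≤n run | inj₁ i<k = contradiction (subst (k ≤_) (sym e) k≤n) (<⇒≱ i<k)
  entry-bound (suc f) j i k 1≤i e i≤k k≤n run | inj₁ i<k with j ≤? lam (suc i)
  ... | no  j≰ = contradiction (run (suc i) ≤-refl i<k) j≰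
  ... | yes _  = ≤-trans (+-monoˡ-≤ k (m⊓n≤n (β i) _))
      (pred+≤ (≤-trans z<s (row≤entry f j (suc i) z<s (fuel-suc f i e)))
        (subst (entry f j (suc i) + k ≤_) (+-suc (β k) i)
          (entry-bound f j (suc i) k z<s (fuel-suc f i e) i<k k≤n (λ m i+1<m m≤k → run m (<-trans ≤-refl i+1<m) m≤k))))
    where
      pred+≤ : ∀ {a k c} → 1 ≤ a → a + k ≤ suc c → pred a + k ≤ c
      pred+≤ {suc a} _ le = s≤s⁻¹ le

  entry-attained : ∀ f j i → 1 ≤ i → f + i ≡ n →
                   ∃ λ k → i ≤ k × k ≤ n × RunFrom lam j i k × entry f j i + k ≡ β k + i
  entry-attained zero j i 1≤i e = i , ≤-refl , fuel⇒≤ 0 e , (λ m i<m m≤i → contradiction m≤i (<⇒≱ i<m)) , refl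
  entry-attained (suc f) j i 1≤i e with j ≤? lam (suc i)
  ... | no _ = i , ≤-refl , fuel⇒≤ (suc f) e , (λ m i<m m≤i → contradiction m≤i (<⇒≱ i<m)) , refl
  ... | yes j≤lam-1+i with ⊓-sel (β i) (pred (entry f j (suc i)))
  ... | inj₁ ⊓≡β rewrite ⊓≡β = i , ≤-refl , fuel⇒≤ (suc f) e , (λ m i<m m≤i → contradiction m≤i (<⇒≱ i<m)) , refl
  ... | inj₂ ⊓≡pred rewrite ⊓≡pred with entry-attained f j (suc i) z<s (fuel-suc f i e)
  ... | k , i<k , k≤n , run , attained = k , ≤-trans (n≤1+n i) i<k , k≤n , run′ ,
        pred+≡ (≤-trans z<s (row≤entry f j (suc i) z<s (fuel-suc f i e))) (trans attained (+-suc (β k) i))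
    where
      pred+≡ : ∀ {a k c} → 1 ≤ a → a + k ≡ suc c → pred a + k ≡ c
      pred+≡ {suc a} _ eq = suc-injective eq
      run′ : RunFrom lam j i k
      run′ m i<m m≤k with m≤n⇒m<n∨m≡n i<m
      ... | inj₁ i+1<m = run m i+1<m m≤k
      ... | inj₂ refl  = j≤lam-1+i

  n∸i≡1+n∸[1+i] : ∀ {i} → suc i ≤ n → n ∸ i ≡ suc (n ∸ suc i)
  n∸i≡1+n∸[1+i] 1+i≤n = +-∸-assoc 1 1+i≤n

  Qβ-ssyt : IsSSYT n lam Qβ
  IsSSYT.entries Qβ-ssyt j i ((1≤i , i≤n) , _) =
    ≤-trans 1≤i (row≤entry (n ∸ i) j i 1≤i (m∸n+n≡m i≤n)) ,
    ≤-trans (entry≤β (n ∸ i) j i) (proj₂ (up i 1≤i i≤n))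
  IsSSYT.rowWeak Qβ-ssyt j i _ _ = entry-monoʳ (n ∸ i) j i
  IsSSYT.colStrict Qβ-ssyt j i _ ((_ , 1+i≤n) , _ , j≤lam-1+i)
    rewrite n∸i≡1+n∸[1+i] 1+i≤n with j ≤? lam (suc i)
  ... | no j≰ = contradiction j≤lam-1+i j≰
  ... | yes _ = ≤-<-trans (m⊓n≤n _ _)
                  (∸1< (≤-trans z<s (row≤entry (n ∸ suc i) j (suc i) z<s (m∸n+n≡m 1+i≤n))))

  InS-Qβ : InS n lam β Qβ
  InS-Qβ = Qβ-ssyt , λ j i _ → entry≤β (n ∸ i) j i

  InS⇒≤Qβ : ∀ T → InS n lam β T → LeT n lam T Qβ
  InS⇒≤Qβ T S j i sh = InS⇒≤entry S (n ∸ i) j i (m∸n+n≡m (proj₂ (proj₁ sh))) sh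

  Qβ-rowEnd-isRunMin : IsPartition n lam → ∀ {i} → 1 ≤ i → i ≤ n →
                       IsRunMin β i (carrelTop n lam i) (Qβ (lam i) i)
  Qβ-rowEnd-isRunMin par {i} 1≤i i≤n = bound , withinCarrel (entry-attained (n ∸ i) (lam i) i 1≤i fuel)
    where
      open IsCarrelTop (Carrels.carrelTop-spec par 1≤i i≤n)
      fuel = m∸n+n≡m i≤n
      bound : ∀ k → i ≤ k → k ≤ carrelTop n lam i → Qβ (lam i) i + k ≤ β k + i
      bound k i≤k k≤q = entry-bound (n ∸ i) (lam i) i k 1≤i fuel i≤k (≤-trans k≤q q≤n)
        (λ m i<m m≤k → ≤-reflexive (sym (constant m (<⇒≤ i<m) (≤-trans m≤k k≤q))))
      withinCarrel : (∃ λ k → i ≤ k × k ≤ n × RunFrom lam (lam i) i k × Qβ (lam i) i + k ≡ β k + i) →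
                     ∃ λ k → i ≤ k × k ≤ carrelTop n lam i × Qβ (lam i) i + k ≡ β k + i
      withinCarrel (k , i≤k , k≤n , run , attained) = k , i≤k , k≤q , attained
        where
          k≤q : k ≤ carrelTop n lam i
          k≤q with carrelTop n lam i <? k
          ... | no  k≰q = ≮⇒≥ k≰q
          ... | yes q<k = contradiction (run _ (s≤s i≤q) q<k) (<⇒≱ (dropAfter (<-≤-trans q<k k≤n)))

rowEnd-empty : ∀ lam (T : Tableau) i → lam i ≡ 0 → rowEnd lam T i ≡ i
rowEnd-empty lam T i e rewrite e = refl

rowEnd-filled : ∀ lam (T : Tableau) i {j} → lam i ≡ suc j → rowEnd lam T i ≡ T (suc j) i
rowEnd-filled lam T i e rewrite e = refl

rowEnd-Qβ≡Δ : ∀ {n lam β} → IsPartition n lam → (up : IsUpper n β) → ∀ i → 1 ≤ i → i ≤ n →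
              rowEnd lam (Greatest.Qβ up) i ≡ Δ n lam β i
rowEnd-Qβ≡Δ {n} {lam} {β} par up i 1≤i i≤n = byRowLength (lam i) refl
  where
    open Greatest up
    open IsCarrelTop (Carrels.carrelTop-spec par 1≤i i≤n)
    byRowLength : ∀ l → lam i ≡ l → rowEnd lam Qβ i ≡ Δ n lam β i
    byRowLength zero lam-i = trans (rowEnd-empty lam Qβ i lam-i)
      (IsRunMin-unique (rowIndex-isRunMin up 1≤i i≤n)
                       (subst (λ q → IsRunMin β i q (Δ n lam β i)) q≡n (Δ-isRunMin par up 1≤i i≤n)))
      where
        q≡n : carrelTop n lam i ≡ n
        q≡n = ≤-antisym q≤n (≮⇒≥ (λ q<n → n≮0 (subst (lam (suc (carrelTop n lam i)) <_) lam-i (dropAfter q<n))))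
    byRowLength (suc j) lam-i = trans (rowEnd-filled lam Qβ i lam-i)
      (IsRunMin-unique (subst (λ l → IsRunMin β i (carrelTop n lam i) (Qβ l i)) lam-i
                              (Qβ-rowEnd-isRunMin par 1≤i i≤n))
                       (Δ-isRunMin par up 1≤i i≤n))

rowWeak* : ∀ {n lam T} → IsSSYT n lam T → ∀ {j j′ i} → InShape n lam j i → j ≤ j′ → j′ ≤ lam i →
           T j i ≤ T j′ i
rowWeak* ss {j} {j′} sh j≤j′ j′≤lam with m≤n⇒m<n∨m≡n j≤j′
... | inj₂ refl = ≤-refl
rowWeak* ss {j} {suc j′} {i} sh _ j′<lam | inj₁ j<1+j′ =
  ≤-trans (rowWeak* ss sh (s≤s⁻¹ j<1+j′) (<⇒≤ j′<lam)) (IsSSYT.rowWeak ss j′ i box box′)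
  where
    box  = proj₁ sh , ≤-trans (proj₁ (proj₂ sh)) (s≤s⁻¹ j<1+j′) , <⇒≤ j′<lam
    box′ = proj₁ sh , z<s , j′<lam

entry≤rowEnd : ∀ {n lam T} → IsSSYT n lam T → ∀ {j i} → InShape n lam j i → T j i ≤ rowEnd lam T i
entry≤rowEnd {lam = lam} {T} ss {j} {i} sh@(_ , 1≤j , j≤lam-i) = byRowLength (lam i) refl
  where
    byRowLength : ∀ l → lam i ≡ l → T j i ≤ rowEnd lam T i
    byRowLength zero    lam-i = contradiction (subst (1 ≤_) lam-i (≤-trans 1≤j j≤lam-i)) λ ()
    byRowLength (suc l) lam-i = subst (T j i ≤_) (sym (rowEnd-filled lam T i lam-i))
      (rowWeak* ss sh (subst (j ≤_) lam-i j≤lam-i) (≤-reflexive (sym lam-i)))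

Below : ℕ → Shape → Tableau → Tableau → Set
Below n lam Q T = IsSSYT n lam T × LeT n lam T Q

LeT-trans : ∀ {n lam T U V} → LeT n lam T U → LeT n lam U V → LeT n lam T V
LeT-trans T≤U U≤V j i sh = ≤-trans (T≤U j i sh) (U≤V j i sh)

EqT-sym : ∀ {n lam T U} → EqT n lam T U → EqT n lam U T
EqT-sym T≈U j i sh = sym (T≈U j i sh)

LeT-antisym : ∀ {n lam T U} → LeT n lam T U → LeT n lam U T → EqT n lam T U
LeT-antisym T≤U U≤T j i sh = ≤-antisym (T≤U j i sh) (U≤T j i sh)

Below-resp-EqT : ∀ {n lam Q Q′} → EqT n lam Q Q′ → ∀ T → Below n lam Q T ⇔ Below n lam Q′ T
Below-resp-EqT Q≈Q′ T = mk⇔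
  (λ (ss , T≤Q) → ss , λ j i sh → subst (T j i ≤_) (Q≈Q′ j i sh) (T≤Q j i sh))
  (λ (ss , T≤Q′) → ss , λ j i sh → subst (T j i ≤_) (sym (Q≈Q′ j i sh)) (T≤Q′ j i sh))

sameBelow⇔EqT : ∀ {n lam} {P P′ : Tableau → Set} {Q Q′} → IsSSYT n lam Q → IsSSYT n lam Q′ →
              (∀ T → P T ⇔ Below n lam Q T) → (∀ T → P′ T ⇔ Below n lam Q′ T) →
              (∀ T → P T ⇔ P′ T) ⇔ EqT n lam Q Q′
sameBelow⇔EqT {Q = Q} {Q′} ssQ ssQ′ P≡↓Q P′≡↓Q′ = mk⇔
  (λ P≡P′ → LeT-antisym
     (proj₂ (to (P′≡↓Q′ Q) (to (P≡P′ Q) (from (P≡↓Q Q) (ssQ , λ _ _ _ → ≤-refl)))))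
     (proj₂ (to (P≡↓Q Q′) (from (P≡P′ Q′) (from (P′≡↓Q′ Q′) (ssQ′ , λ _ _ _ → ≤-refl))))))
  (λ Q≈Q′ T → ⇔.trans (P≡↓Q T) (⇔.trans (Below-resp-EqT Q≈Q′ T) (⇔.sym (P′≡↓Q′ T))))

InS⇔Below-LUB : ∀ {n lam β Q} → IsUpper n β → IsLUB n lam (InS n lam β) Q →
                ∀ T → InS n lam β T ⇔ Below n lam Q T
InS⇔Below-LUB {n} {lam} {β} {Q} up (_ , upper , least) T = mk⇔
  (λ S → proj₁ S , upper T S)
  (λ (ss , T≤Q) → ss , λ j i sh → ≤-trans (LeT-trans T≤Q Q≤Qβ j i sh) (proj₂ InS-Qβ j i sh))
  where
    open Greatest up
    Q≤Qβ : LeT n lam Q Qβ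
    Q≤Qβ = least Qβ Qβ-ssyt InS⇒≤Qβ

maxRowEnd-Δ≈LUB : ∀ {n lam β Q M} → IsPartition n lam → IsUpper n β → IsLUB n lam (InS n lam β) Q →
                  IsMaxRowEnd n lam (Δ n lam β) M → EqT n lam M Q
maxRowEnd-Δ≈LUB {n} {lam} {β} {Q} {M} par up (_ , upper , least) (ssM , rowEndM , maximal) =
  LeT-antisym (upper M InS-M) (LeT-trans (least Qβ Qβ-ssyt InS⇒≤Qβ) Qβ≤M)
  where
    open Greatest up
    Qβ≤M : LeT n lam Qβ M
    Qβ≤M = maximal Qβ Qβ-ssyt (rowEnd-Qβ≡Δ par up)
    Δ≤β : ∀ i → 1 ≤ i → i ≤ n → Δ n lam β i ≤ β i
    Δ≤β i 1≤i i≤n = IsRunMin⇒≤start (Δ-isRunMin par up 1≤i i≤n)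
                      (IsCarrelTop.i≤q (Carrels.carrelTop-spec par 1≤i i≤n))
    InS-M : InS n lam β M
    InS-M = ssM , λ j i sh@((1≤i , i≤n) , _) →
      ≤-trans (entry≤rowEnd ssM sh) (≤-trans (≤-reflexive (rowEndM i 1≤i i≤n)) (Δ≤β i 1≤i i≤n))

proposition8p4 : (n : ℕ) → 1 ≤ n →
    (lam : Shape) → IsPartition n lam →
    (β β' : Tuple) → IsUpper n β → IsUpper n β' →
    (Q Q' : Tableau) →
    IsLUB n lam (InS n lam β) Q → IsLUB n lam (InS n lam β') Q' →
    ((∀ T → InS n lam β T ⇔ (IsSSYT n lam T × LeT n lam T Q))
    × ((∀ T → InS n lam β T ⇔ InS n lam β' T) ⇔ EqT n lam Q Q'))
    × (∀ M → IsMaxRowEnd n lam (Δ n lam β) M →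
    EqT n lam M Q
    × (∀ T → InS n lam β T ⇔ (IsSSYT n lam T × LeT n lam T M)))
proposition8p4 n _ lam par β β' up up' Q Q' lub lub' =
  (S≡↓Q , sameBelow⇔EqT (proj₁ lub) (proj₁ lub') S≡↓Q (InS⇔Below-LUB up' lub')) ,
  λ M max → let M≈Q = maxRowEnd-Δ≈LUB par up lub max in
    M≈Q , λ T → ⇔.trans (S≡↓Q T) (Below-resp-EqT (EqT-sym M≈Q) T)
  where
    S≡↓Q = InS⇔Below-LUB up lub
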